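{- Define the relation $\succ^s$ on $\mathcal{EL}$ GCIs and $\mathcal{EL}$ concept assertions by: $C\sqsubseteq D\ \succ^s\ C'\sqsubseteq D'$ iff $C'\sqsubseteq^\emptyset C$, $D\sqsubseteq^\emptyset D'$ and $\{C'\sqsubseteq D'\}\not\models C\sqsubseteq D$; and $D(a)\succ^s D'(a)$ iff $D\sqsubset^\emptyset D'$ (and no other pairs are related). Then $\succ^s$ is a complete weakening relation.
   Context: $\mathcal{EL}$ concepts: $C::=A\mid\top\mid C\sqcap C\mid\exists r.C$ ($A$ concept name, $r$ role name); GCIs $C\sqsubseteq D$ and concept assertions $C(a)$ ($a$ an individual name) are interpreted as usual: $\top^\mathcal{I}=\Delta^\mathcal{I}$, $(C\sqcap D)^\mathcal{I}=C^\mathcal{I}\cap D^\mathcal{I}$, $(\exists r.C)^\mathcal{I}=\{d\mid\exists e\in C^\mathcal{I},(d,e)\in r^\mathcal{I}\}$; $\mathcal{I}$ satisfies $C\sqsubseteq D$ iff $C^\mathcal{I}\subseteq D^\mathcal{I}$ and $C(a)$ iff $a^\mathcal{I}\in C^\mathcal{I}$. $\mathfrak{O}\models\alpha$ iff every model of $\mathfrak{O}$ satisfies $\alpha$; $\mathit{Con}(\mathfrak{O})=\{\alpha\mid\mathfrak{O}\models\alpha\}$. A tautology is an axiom $\alpha$ with $\emptyset\models\alpha$. $C\sqsubseteq^\emptyset D$ means that $C\sqsubseteq D$ is a tautology; $C\equiv^\emptyset D$ means $C\sqsubseteq^\emptyset D$ and $D\sqsubseteq^\emptyset C$; $C\sqsubset^\emptyset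 D$ means $C\sqsubseteq^\emptyset D$ and $C\not\equiv^\emptyset D$. A pre-order (irreflexive, transitive relation) $\succ$ on axioms is a weakening relation if $\beta\succ\gamma$ implies $\mathit{Con}(\{\gamma\})\subsetneq\mathit{Con}(\{\beta\})$, and is complete if for every non-tautological axiom $\beta$ there is a tautology $\gamma$ with $\beta\succ\gamma$. -}

module Defs where

open import Level using (Level; Lift) renaming (suc to lsuc; zero to lzero)
open import Data.Empty using (⊥)
open import Data.Unit using (⊤)
open import Relation.Binary.PropositionalEquality using (_≡_)
open import Data.Product using (_×_; Σ; ∃; _,_)
open import Data.List using (List; []; _∷_)
open import Data.List.Relation.Unary.All using (All)
open import Relation.Nullary using (¬_)

data Concept (NC NR : Set) : Set where
  atom : NC → Concept NC NR
  ⊤ᶜ   : Concept NC NR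
  _⊓_  : Concept NC NR → Concept NC NR → Concept NC NR
  ∃[_]_ : NR → Concept NC NR → Concept NC NR

data Axiom (NC NR NI : Set) : Set where
  _⊑_  : Concept NC NR → Concept NC NR → Axiom NC NR NI
  _⟨_⟩ : Concept NC NR → NI → Axiom NC NR NI

-- Interpretations (domain is a Set; need not be non-empty constructively,
-- but it always contains the interpretation of individuals when NI is inhabited)
record Interp (NC NR NI : Set) : Set₁ where
  field
    Δ    : Set
    conc : NC → Δ → Set
    role : NR → Δ → Δ → Set
    ind  : NI → Δ

_⊆ₚ_ : {A : Set} → (A → Set₁) → (A → Set₁) → Set₁
P ⊆ₚ Q = ∀ x → P x → Q x

_⊊ₚ_ : {A : Set} → (A → Set₁) → (A → Set₁) → Set₁
P ⊊ₚ Q = (P ⊆ₚ Q) × ¬ (Q ⊆ₚ P)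

module _ {NC NR NI : Set} where

  ⟦_⟧ : Concept NC NR → (I : Interp NC NR NI) → Interp.Δ I → Set
  ⟦ atom A ⟧ I d = Interp.conc I A d
  ⟦ ⊤ᶜ ⟧ I d = ⊤
  ⟦ C ⊓ D ⟧ I d = ⟦ C ⟧ I d × ⟦ D ⟧ I d
  ⟦ ∃[ r ] C ⟧ I d = Σ (Interp.Δ I) λ e → Interp.role I r d e × ⟦ C ⟧ I e

  _⊨ᵢ_ : Interp NC NR NI → Axiom NC NR NI → Set
  I ⊨ᵢ (C ⊑ D) = ∀ d → ⟦ C ⟧ I d → ⟦ D ⟧ I d
  I ⊨ᵢ (C ⟨ a ⟩) = ⟦ C ⟧ I (Interp.ind I a)

  Model : Interp NC NR NI → List (Axiom NC NR NI) → Set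
  Model I O = All (I ⊨ᵢ_) O

  _⊨_ : List (Axiom NC NR NI) → Axiom NC NR NI → Set₁
  O ⊨ α = (I : Interp NC NR NI) → Model I O → I ⊨ᵢ α

  Con : List (Axiom NC NR NI) → Axiom NC NR NI → Set₁
  Con O α = O ⊨ α

  Tautology : Axiom NC NR NI → Set₁
  Tautology α = [] ⊨ α

  _⊑∅_ : Concept NC NR → Concept NC NR → Set₁
  C ⊑∅ D = Tautology (C ⊑ D)

  _≡∅_ : Concept NC NR → Concept NC NR → Set₁
  C ≡∅ D = (C ⊑∅ D) × (D ⊑∅ C)

  _⊏∅_ : Concept NC NR → Concept NC NR → Set₁
  C ⊏∅ D = (C ⊑∅ D) × ¬ (C ≡∅ D)


  Rel₁ : Set₂
  Rel₁ = Axiom NC NR NI → Axiom NC NR NI → Set₁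

  -- "pre-order" in the paper's sense: irreflexive and transitive
  IsStrictPreorder : Rel₁ → Set₁
  IsStrictPreorder _≻_ =
    (∀ x → ¬ (x ≻ x)) × (∀ x y z → x ≻ y → y ≻ z → x ≻ z)

  IsWeakeningRelation : Rel₁ → Set₁
  IsWeakeningRelation _≻_ =
    IsStrictPreorder _≻_ ×
    (∀ β γ → β ≻ γ → Con (γ ∷ []) ⊊ₚ Con (β ∷ []))

  IsComplete : Rel₁ → Set₁
  IsComplete _≻_ =
    ∀ β → ¬ Tautology β → Σ (Axiom NC NR NI) λ γ → Tautology γ × (β ≻ γ)

  IsCompleteWeakeningRelation : Rel₁ → Set₁
  IsCompleteWeakeningRelation _≻_ = IsWeakeningRelation _≻_ × IsComplete _≻_

  _≻ˢ_ : Rel₁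
  (C ⊑ D) ≻ˢ (C' ⊑ D') =
    (C' ⊑∅ C) × (D ⊑∅ D') × ¬ (((C' ⊑ D') ∷ []) ⊨ (C ⊑ D))
  (C ⊑ D) ≻ˢ (_ ⟨ _ ⟩) = Lift (lsuc lzero) ⊥
  (_ ⟨ _ ⟩) ≻ˢ (_ ⊑ _) = Lift (lsuc lzero) ⊥
  (D ⟨ a ⟩) ≻ˢ (D' ⟨ a' ⟩) = Lift (lsuc lzero) (a ≡ a') × (D ⊏∅ D')

module Submission where

open import Defs
open import Level using (lift)
open import Data.Unit using (tt)
open import Data.Product using (_,_; map)
open import Data.List using ([]; _∷_)
open import Data.List.Relation.Unary.All using ([]; _∷_)
open import Function using (_∘_; id; const)
open import Function.Bundles using (_⇔_; mk⇔; Equivalence)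
open import Relation.Nullary using (¬_)
open import Relation.Binary.PropositionalEquality using (refl; trans)

-- Con({γ}) ⊊ Con({β}) holds exactly when {β} ⊨ γ and {γ} ⊭ β. For GCIs,
-- {C ⊑ D} ⊨ C' ⊑ D' follows from the tautological inclusions C' ⊑ C and D ⊑ D'.
-- For assertions, {D(a)} ⊨ D'(a) is equivalent to D ⊑∅ D': extensions of concepts
-- do not depend on the interpretation of individuals, so a can be sent to any
-- element of the domain. Completeness weakens C ⊑ D to C ⊑ ⊤ and D(a) to ⊤(a).

module _ {NC NR NI : Set} where

  ⊨-refl : {α : Axiom NC NR NI} → (α ∷ []) ⊨ α
  ⊨-refl I (Iα ∷ []) = Iα

  Con-⊆ : {α β : Axiom NC NR NI} → (α ∷ []) ⊨ β → Con (β ∷ []) ⊆ₚ Con (α ∷ [])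
  Con-⊆ α⊨β γ β⊨γ I (Iα ∷ []) = β⊨γ I (α⊨β I (Iα ∷ []) ∷ [])

  ⊨-trans : {α β γ : Axiom NC NR NI} →
            (α ∷ []) ⊨ β → (β ∷ []) ⊨ γ → (α ∷ []) ⊨ γ
  ⊨-trans {γ = γ} α⊨β = Con-⊆ α⊨β γ

  Con-⊊ : {β γ : Axiom NC NR NI} →
          (β ∷ []) ⊨ γ → ¬ ((γ ∷ []) ⊨ β) → Con (γ ∷ []) ⊊ₚ Con (β ∷ [])
  Con-⊊ {β} β⊨γ γ⊭β = Con-⊆ β⊨γ , λ γ⊆β → γ⊭β (γ⊆β β ⊨-refl)

  ⊨-tautology : {α β : Axiom NC NR NI} →
                Tautology α → (α ∷ []) ⊨ β → Tautology β
  ⊨-tautology ⊨α α⊨β I [] = α⊨β I (⊨α I [] ∷ [])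

  ⊑∅-refl : (C : Concept NC NR) → _⊑∅_ {NI = NI} C C
  ⊑∅-refl C I [] d x = x

  ⊑∅-trans : (C D E : Concept NC NR) →
             _⊑∅_ {NI = NI} C D → _⊑∅_ {NI = NI} D E → _⊑∅_ {NI = NI} C E
  ⊑∅-trans C D E C⊑D D⊑E I [] d = D⊑E I [] d ∘ C⊑D I [] d

  ⊑∅-⊤ : (C : Concept NC NR) → _⊑∅_ {NI = NI} C ⊤ᶜ
  ⊑∅-⊤ C I [] d _ = tt

  ⊏∅-irrefl : (C : Concept NC NR) → ¬ (_⊏∅_ {NI = NI} C C)
  ⊏∅-irrefl C (C⊑C , C≢C) = C≢C (C⊑C , C⊑C)

  ⊏∅-trans : (C D E : Concept NC NR) →
             _⊏∅_ {NI = NI} C D → _⊏∅_ {NI = NI} D E → _⊏∅_ {NI = NI} C E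
  ⊏∅-trans C D E (C⊑D , C≢D) (D⊑E , _) =
    ⊑∅-trans C D E C⊑D D⊑E , λ (_ , E⊑C) → C≢D (C⊑D , ⊑∅-trans D E C D⊑E E⊑C)

  ⊑-weaken : (C C' D D' : Concept NC NR) →
             _⊑∅_ {NI = NI} C' C → _⊑∅_ {NI = NI} D D' → ((C ⊑ D) ∷ []) ⊨ (C' ⊑ D')
  ⊑-weaken C C' D D' C'⊑C D⊑D' I (C⊑D ∷ []) d = D⊑D' I [] d ∘ C⊑D d ∘ C'⊑C I [] d

  withInd : (I : Interp NC NR NI) → (NI → Interp.Δ I) → Interp NC NR NI
  withInd I ι = record
    { Δ = Interp.Δ I ; conc = Interp.conc I ; role = Interp.role I ; ind = ι }

  ⟦⟧-withInd : (C : Concept NC NR) (I : Interp NC NR NI) (ι : NI → Interp.Δ I)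
               (e : Interp.Δ I) → ⟦ C ⟧ (withInd I ι) e ⇔ ⟦ C ⟧ I e
  ⟦⟧-withInd (atom A) I ι e = mk⇔ id id
  ⟦⟧-withInd ⊤ᶜ I ι e = mk⇔ id id
  ⟦⟧-withInd (C ⊓ D) I ι e =
    mk⇔ (map (Equivalence.to (⟦⟧-withInd C I ι e)) (Equivalence.to (⟦⟧-withInd D I ι e)))
        (map (Equivalence.from (⟦⟧-withInd C I ι e)) (Equivalence.from (⟦⟧-withInd D I ι e)))
  ⟦⟧-withInd (∃[ r ] C) I ι e =
    mk⇔ (λ (f , ef , x) → f , ef , Equivalence.to (⟦⟧-withInd C I ι f) x)
        (λ (f , ef , x) → f , ef , Equivalence.from (⟦⟧-withInd C I ι f) x)

  ⟨⟩-entails : (D D' : Concept NC NR) (a : NI) →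
               ((D ⟨ a ⟩) ∷ []) ⊨ (D' ⟨ a ⟩) ⇔ D ⊑∅ D'
  ⟨⟩-entails D D' a = mk⇔ entailed⇒subsumed subsumed⇒entailed
    where
    subsumed⇒entailed : D ⊑∅ D' → ((D ⟨ a ⟩) ∷ []) ⊨ (D' ⟨ a ⟩)
    subsumed⇒entailed D⊑D' I (Da ∷ []) = D⊑D' I [] _ Da

    entailed⇒subsumed : ((D ⟨ a ⟩) ∷ []) ⊨ (D' ⟨ a ⟩) → D ⊑∅ D'
    entailed⇒subsumed Da⊨D'a I [] d Dd =
      Equivalence.to (⟦⟧-withInd D' I (const d) d)
        (Da⊨D'a (withInd I (const d)) (Equivalence.from (⟦⟧-withInd D I (const d) d) Dd ∷ []))

  ≻ˢ-irrefl : ∀ α → ¬ (α ≻ˢ α)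
  ≻ˢ-irrefl (C ⊑ D) (_ , _ , α⊭α) = α⊭α ⊨-refl
  ≻ˢ-irrefl (D ⟨ a ⟩) (_ , D⊏D) = ⊏∅-irrefl D D⊏D

  ≻ˢ-trans : ∀ α β γ → α ≻ˢ β → β ≻ˢ γ → α ≻ˢ γ
  ≻ˢ-trans (C ⊑ D) (C' ⊑ D') (C'' ⊑ D'') (C'⊑C , D⊑D' , β⊭α) (C''⊑C' , D'⊑D'' , γ⊭β) =
    ⊑∅-trans C'' C' C C''⊑C' C'⊑C , ⊑∅-trans D D' D'' D⊑D' D'⊑D'' ,
    λ γ⊨α → γ⊭β (⊨-trans {γ = C' ⊑ D'} γ⊨α (⊑-weaken C C' D D' C'⊑C D⊑D'))
  ≻ˢ-trans (D ⟨ a ⟩) (D' ⟨ a' ⟩) (D'' ⟨ a'' ⟩) (lift a≡a' , D⊏D') (lift a'≡a'' , D'⊏D'') =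
    lift (trans a≡a' a'≡a'') , ⊏∅-trans D D' D'' D⊏D' D'⊏D''

  ≻ˢ-weakening : ∀ β γ → β ≻ˢ γ → Con (γ ∷ []) ⊊ₚ Con (β ∷ [])
  ≻ˢ-weakening (C ⊑ D) (C' ⊑ D') (C'⊑C , D⊑D' , γ⊭β) =
    Con-⊊ (⊑-weaken C C' D D' C'⊑C D⊑D') γ⊭β
  ≻ˢ-weakening (D ⟨ a ⟩) (D' ⟨ .a ⟩) (lift refl , D⊑D' , D≢D') =
    Con-⊊ (Equivalence.from (⟨⟩-entails D D' a) D⊑D')
          (λ D'a⊨Da → D≢D' (D⊑D' , Equivalence.to (⟨⟩-entails D' D a) D'a⊨Da))

  ⊤⟨⟩-tautology : (a : NI) → Tautology {NC} {NR} (⊤ᶜ ⟨ a ⟩)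
  ⊤⟨⟩-tautology a I [] = tt

  ≻ˢ-complete : IsComplete (_≻ˢ_ {NC} {NR} {NI})
  ≻ˢ-complete (C ⊑ D) ⊭C⊑D =
    C ⊑ ⊤ᶜ , ⊑∅-⊤ C , ⊑∅-refl C , ⊑∅-⊤ D ,
    ⊭C⊑D ∘ ⊨-tautology {C ⊑ ⊤ᶜ} {C ⊑ D} (⊑∅-⊤ C)
  ≻ˢ-complete (D ⟨ a ⟩) ⊭Da =
    ⊤ᶜ ⟨ a ⟩ , ⊤⟨⟩-tautology a , lift refl , ⊑∅-⊤ D ,
    λ (_ , ⊤⊑D) → ⊭Da (⊨-tautology {β = D ⟨ a ⟩} (⊤⟨⟩-tautology a)
                                   (Equivalence.from (⟨⟩-entails ⊤ᶜ D a) ⊤⊑D))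

proposition18 : (NC NR NI : Set) →
    IsCompleteWeakeningRelation (_≻ˢ_ {NC} {NR} {NI})
proposition18 NC NR NI = ((≻ˢ-irrefl , ≻ˢ-trans) , ≻ˢ-weakening) , ≻ˢ-complete
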